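{- Let $S$ and $S'$ be finite sequences of simple pattern terms, let $S_1\in\upsilon(S)$ and $S'_1\in\upsilon(S')$, and suppose that $\theta\in\mathit{mgu}(S_1,S'_1)$ is a simple substitution. Then $\upsilon^{ -1}(\theta)$ is a most general unifier of $S$ and $S'$ (in the sense of pattern terms). Equivalently: if the unification algorithm (choose $S_1\in\upsilon(S)$, $S'_1\in\upsilon(S')$; if $\mathit{mgu}(S_1,S'_1)$ contains a simple substitution $\theta$, return $\upsilon^{ -1}(\theta)$, else fail) terminates successfully, its output is an mgu of $S$ and $S'$.
   Context: Fix a signature $\Sigma$, hole constants $\square_1,\square_2,\dots$ and an infinite countable set $X$ of variables, pairwise disjoint. $T(\Sigma,X)$ is the set of terms, $S(\Sigma,X)$ the set of substitutions; composition $x(\sigma\theta)=(x\sigma)\theta$, $\emptyset$ the identity, $\sigma^0=\emptyset$, $\sigma^{n+1}=\sigma^n\sigma$. A 1-context is a term over $\Sigma\cup\{\square_1,\square_2,\dots\}$ and $X$ containing $\square_1$ and no other hole; $c(s)$ replaces every $\square_1$ by $s$; $c^0=\square_1$, $c^{n+1}=c(c^n)$; $\chi^{(1)}$ is the set of 1-contexts without variables. $\Upsilon$ is a set of new unary function symbols $c^{a,b}$ ($c\in\chi^{(1)}$, $a,b\in\mathbb N$). $\mathit{mgu}(S_1,S'_1)$ for sequences in $T(\Sigma\cup\Upsilon,X)$ is the usual set of most general unifiers, treating symbols of $\Upsilon$ as ordinary unary function symbols. For $u\in T(\Sigma\cup\Upsilon,X)$, $u(n)\in T(\Sigma,X)$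 is obtained by replacing every symbol $c^{a,b}$ by the nesting $c^{a\times n+b}$; for $\theta\in S(\Sigma\cup\Upsilon,X)$, $(\theta(n))(x)=(\theta(x))(n)$. $u\sim v$ iff $u(n)=v(n)$ for all $n$; $[u]$ is the $\sim$-class. A pattern substitution is a pair $(\sigma,\mu)\in S(\Sigma,X)^2$ with $(\sigma,\mu)(n)=\sigma^n\mu$. A pattern term is $p=(s,(\sigma,\mu))$, $s\in T(\Sigma,X)$, with $p(n)=s\sigma^n\mu$. A pattern substitution $\vartheta$ is a most general unifier of two sequences $\langle p_1,\dots,p_m\rangle$, $\langle q_1,\dots,q_m\rangle$ of pattern terms if for every $n\in\mathbb N$, $\vartheta(n)\in\mathit{mgu}(\langle p_1(n),\dots,p_m(n)\rangle,\langle q_1(n),\dots,q_m(n)\rangle)$. A pattern term $p=(s,(\sigma,\mu))$ is simple if for every $x\in\mathit{Var}(s)$ there exist $c\in\chi^{(1)}$, $a,b\in\mathbb N$, $t\in T(\Sigma,X)$ with $\sigma(x)=c^a(x)$ and $\mu(x)=c^b(t)$; then $\upsilon(p)=[s\theta_p]$, where $\theta_p(x)=\mu(x)$ if $\sigma(x)=x$ and $\theta_p(x)=c^{a,b}(t)$ otherwise ($x\in\mathit{Var}(s)$). For a sequence $S=\langle p_1,\dots,p_m\rangle$ of simple pattern terms, $\upsilon(S)=\{\langle u_1,\dots,u_m\rangle\mid u_i\in\upsilon(p_i)\}$. A substitution $\theta\in S(\Sigma\cup\Upsilon,X)$ is simple if for every $x\in X$, $\theta(x)\in[c^{a,b}(t)]$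 for some $c\in\chi^{(1)}$, $a,b\in\mathbb N$, $t\in T(\Sigma,X)$; then $\upsilon^{ -1}(\theta)$ is the pattern substitution $(\sigma,\mu)$ with $\sigma(x)=c^a(x)$ and $\mu(x)=c^b(t)$ whenever $\theta(x)\in[c^{a,b}(t)]$. -}

module Defs where

open import Data.Nat using (ℕ; zero; suc; _+_; _*_)
open import Data.Bool using (Bool; true; false; _∧_; _∨_; T)
open import Data.Unit using (⊤; tt)
open import Data.Sum using (_⊎_; inj₁; inj₂; [_,_])
open import Data.Product using (Σ; _×_; _,_; ∃; ∃-syntax; Σ-syntax)
open import Data.Vec using (Vec; []; _∷_; lookup)
open import Data.Fin using (Fin)
open import Relation.Binary.PropositionalEquality using (_≡_; _≢_)

record Signature : Set₁ where
  field
    Sym   : Set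
    arity : Sym → ℕ
open Signature public

data Term (Sg : Signature) : Set where
  var : ℕ → Term Sg
  fun : (f : Sym Sg) → Vec (Term Sg) (arity Sg f) → Term Sg

Subst : Signature → Set
Subst Sg = ℕ → Term Sg

idS : ∀ {Sg} → Subst Sg
idS = var

mutual
  _⟪_⟫ : ∀ {Sg} → Term Sg → Subst Sg → Term Sg
  var x ⟪ θ ⟫ = θ x
  fun f ts ⟪ θ ⟫ = fun f (ts ⟪ θ ⟫s)

  _⟪_⟫s : ∀ {Sg n} → Vec (Term Sg) n → Subst Sg → Vec (Term Sg) n
  [] ⟪ θ ⟫s = []
  (t ∷ ts) ⟪ θ ⟫s = (t ⟪ θ ⟫) ∷ (ts ⟪ θ ⟫s)

_∘ˢ_ : ∀ {Sg} → Subst Sg → Subst Sg → Subst Sg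
(σ ∘ˢ θ) x = σ x ⟪ θ ⟫

_^ˢ_ : ∀ {Sg} → Subst Sg → ℕ → Subst Sg
σ ^ˢ zero = idS
σ ^ˢ suc n = (σ ^ˢ n) ∘ˢ σ

mutual
  data _∈V_ {Sg} (x : ℕ) : Term Sg → Set where
    here : x ∈V var x
    there : ∀ {f ts} → x ∈Vs ts → x ∈V fun f ts

  data _∈Vs_ {Sg} (x : ℕ) : ∀ {n} → Vec (Term Sg) n → Set where
    hd : ∀ {n t} {ts : Vec (Term Sg) n} → x ∈V t → x ∈Vs (t ∷ ts)
    tl : ∀ {n t} {ts : Vec (Term Sg) n} → x ∈Vs ts → x ∈Vs (t ∷ ts)

Unifier : ∀ {Sg m} → Vec (Term Sg) m → Vec (Term Sg) m → Subst Sg → Set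
Unifier ss ts θ = ∀ i → lookup ss i ⟪ θ ⟫ ≡ lookup ts i ⟪ θ ⟫

IsMGU : ∀ {Sg m} → Vec (Term Sg) m → Vec (Term Sg) m → Subst Sg → Set
IsMGU {Sg} ss ts θ =
  Unifier ss ts θ ×
  (∀ (θ' : Subst Sg) → Unifier ss ts θ' → ∃[ η ] (∀ x → θ' x ≡ θ x ⟪ η ⟫))

module Over (Sg : Signature) where

  Tm : Set
  Tm = Term Sg

  -- terms over Σ ∪ {□₁}: holes other than □₁ are excluded up front
  CtxSig : Signature
  CtxSig = record { Sym = Sym Sg ⊎ ⊤ ; arity = [ arity Sg , (λ _ → 0) ] }

  mutual
    noVars : Term CtxSig → Bool
    noVars (var x) = false
    noVars (fun f ts) = noVarss ts

    noVarss : ∀ {n} → Vec (Term CtxSig) n → Bool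
    noVarss [] = true
    noVarss (t ∷ ts) = noVars t ∧ noVarss ts

  mutual
    hasHole : Term CtxSig → Bool
    hasHole (var x) = false
    hasHole (fun (inj₁ f) ts) = hasHoles ts
    hasHole (fun (inj₂ tt) ts) = true

    hasHoles : ∀ {n} → Vec (Term CtxSig) n → Bool
    hasHoles [] = false
    hasHoles (t ∷ ts) = hasHole t ∨ hasHoles ts

  record Chi1 : Set where
    constructor mkChi1
    field
      ctx : Term CtxSig
      .ground : T (noVars ctx)
      .holey : T (hasHole ctx)
  open Chi1 public

  mutual
    plug : Term CtxSig → Tm → Tm
    plug (var x) s = var x
    plug (fun (inj₁ f) ts) s = fun f (plugs ts s)
    plug (fun (inj₂ tt) []) s = s

    plugs : ∀ {n} → Vec (Term CtxSig) n → Tm → Vec Tm n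
    plugs [] s = []
    plugs (t ∷ ts) s = plug t s ∷ plugs ts s

  _^_⟨_⟩ : Chi1 → ℕ → Tm → Tm
  c ^ zero ⟨ s ⟩ = s
  c ^ suc k ⟨ s ⟩ = plug (ctx c) (c ^ k ⟨ s ⟩)

  -- Σ ∪ Υ, with Υ = { c^{a,b} | c ∈ χ⁽¹⁾, a,b ∈ ℕ } unary
  ExtSig : Signature
  ExtSig = record { Sym = Sym Sg ⊎ (Chi1 × ℕ × ℕ)
                  ; arity = [ arity Sg , (λ _ → 1) ] }

  ETm : Set
  ETm = Term ExtSig

  mutual
    embed : Tm → ETm
    embed (var x) = var x
    embed (fun f ts) = fun (inj₁ f) (embeds ts)

    embeds : ∀ {n} → Vec Tm n → Vec ETm n
    embeds [] = []
    embeds (t ∷ ts) = embed t ∷ embeds ts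

  ups : Chi1 → ℕ → ℕ → ETm → ETm
  ups c a b u = fun (inj₂ (c , a , b)) (u ∷ [])

  mutual
    at : ETm → ℕ → Tm
    at (var x) n = var x
    at (fun (inj₁ f) ts) n = fun f (ats ts n)
    at (fun (inj₂ (c , a , b)) (u ∷ [])) n = c ^ (a * n + b) ⟨ at u n ⟩

    ats : ∀ {k} → Vec ETm k → ℕ → Vec Tm k
    ats [] n = []
    ats (u ∷ us) n = at u n ∷ ats us n

  _∼_ : ETm → ETm → Set
  u ∼ v = ∀ n → at u n ≡ at v n

  PatSubst : Set
  PatSubst = Subst Sg × Subst Sg

  evalPS : PatSubst → ℕ → Subst Sg
  evalPS (σ , μ) n = (σ ^ˢ n) ∘ˢ μ

  PatTerm : Set
  PatTerm = Tm × PatSubst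

  evalPT : PatTerm → ℕ → Tm
  evalPT (s , (σ , μ)) n = (s ⟪ σ ^ˢ n ⟫) ⟪ μ ⟫

  evalPTs : ∀ {m} → Vec PatTerm m → ℕ → Vec Tm m
  evalPTs [] n = []
  evalPTs (p ∷ ps) n = evalPT p n ∷ evalPTs ps n

  PatMGU : ∀ {m} → Vec PatTerm m → Vec PatTerm m → PatSubst → Set
  PatMGU ps qs ϑ = ∀ n → IsMGU (evalPTs ps n) (evalPTs qs n) (evalPS ϑ n)

  SimplePT : PatTerm → Set
  SimplePT (s , (σ , μ)) =
    ∀ x → x ∈V s →
      Σ[ c ∈ Chi1 ] Σ[ a ∈ ℕ ] Σ[ b ∈ ℕ ] Σ[ t ∈ Tm ]
        (σ x ≡ c ^ a ⟨ var x ⟩ × μ x ≡ c ^ b ⟨ t ⟩)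

  -- w is a value of θ_p(x) for some choice of simplicity witnesses
  ThetaP : Subst Sg → Subst Sg → ℕ → ETm → Set
  ThetaP σ μ x w =
    (σ x ≡ var x × w ≡ embed (μ x)) ⊎
    (σ x ≢ var x ×
      Σ[ c ∈ Chi1 ] Σ[ a ∈ ℕ ] Σ[ b ∈ ℕ ] Σ[ t ∈ Tm ]
        (σ x ≡ c ^ a ⟨ var x ⟩ × μ x ≡ c ^ b ⟨ t ⟩ × w ≡ ups c a b (embed t)))

  InUps : PatTerm → ETm → Set
  InUps (s , (σ , μ)) u =
    Σ[ θ ∈ Subst ExtSig ]
      ((∀ x → x ∈V s → ThetaP σ μ x (θ x)) × u ∼ (embed s ⟪ θ ⟫))

  InUpsSeq : ∀ {m} → Vec PatTerm m → Vec ETm m → Set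
  InUpsSeq ps us = ∀ i → InUps (lookup ps i) (lookup us i)

  SimpleSubst : Subst ExtSig → Set
  SimpleSubst θ =
    ∀ x → Σ[ c ∈ Chi1 ] Σ[ a ∈ ℕ ] Σ[ b ∈ ℕ ] Σ[ t ∈ Tm ]
      (θ x ∼ ups c a b (embed t))

  -- ϑ = υ⁻¹(θ) (for some choice of representatives)
  IsUpsInv : Subst ExtSig → PatSubst → Set
  IsUpsInv θ (σ , μ) =
    ∀ x → Σ[ c ∈ Chi1 ] Σ[ a ∈ ℕ ] Σ[ b ∈ ℕ ] Σ[ t ∈ Tm ]
      (θ x ∼ ups c a b (embed t) × σ x ≡ c ^ a ⟨ var x ⟩ × μ x ≡ c ^ b ⟨ t ⟩)

-- Evaluation at a level n commutes with substitution, so S(n), S'(n) and ϑ(n) are the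
-- evaluations of S₁, S'₁ and θ, and ϑ(n) unifies S(n) and S'(n). For generality, run
-- the Martelli–Montanari unification algorithm on S₁ ≐ S'₁ in the extended signature,
-- guided by the known unifier θ: θ rules out clashes and occurs-check failures, and the
-- size of the left-hand sides under θ decreases. Every rule is sound at all levels n at
-- once (a symbol c^{a,b} may be decomposed because c^k is injective), so the resulting
-- solution θ₀ satisfies η = θ₀(n) η for every unifier η of S₁(n) ≐ S'₁(n). Since θ₀ is an
-- instance θ ζ of the mgu θ, this gives η = θ(n) (ζ(n) η).
module Submission where

open import Defs
open import Data.Nat using (ℕ; zero; suc; _+_; _*_; _≤_; _<_; z≤n; s≤s; _≟_)
open import Data.Nat.Properties
  using (≤-refl; ≤-trans; ≤-reflexive; m≤m+n; m≤n+m; m≤n⇒m≤1+n; m<n+m; +-comm; +-assoc; *-suc; *-zeroʳ; <⇒≢)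
open import Data.Nat.Induction using (<-wellFounded)
open import Data.Bool using (T)
open import Data.Bool.Properties using (T?; T-∧; T-∨)
open import Data.Empty using (⊥-elim)
open import Data.Sum using (inj₁; inj₂)
open import Data.Product using (_×_; _,_; proj₁; proj₂; ∃-syntax) renaming (map to ×-map)
open import Data.List using (List; []; _∷_; _++_; map)
open import Data.Nat.ListAction using (sum)
import Data.List.Relation.Unary.All as List
open import Data.List.Relation.Unary.All.Properties using (map⁺; map⁻; ++⁺; ++⁻)
open import Data.Vec using (Vec; []; _∷_; lookup; toList; zip)
open import Data.Vec.Properties using (∷-injectiveˡ; ∷-injectiveʳ)
open import Data.Vec.Relation.Unary.All using (All)
open import Data.Fin using (zero; suc)
open import Function using (_∘_; Equivalence)
open import Induction.WellFounded using (Acc; acc)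
open import Relation.Nullary using (yes; no; ¬_)
open import Relation.Nullary.Decidable using (recompute)
open import Relation.Binary.PropositionalEquality
open ≡-Reasoning

module _ {Sg : Signature} where

  mutual
    ⟪⟫-local : ∀ {θ ζ : Subst Sg} t → (∀ x → x ∈V t → θ x ≡ ζ x) → t ⟪ θ ⟫ ≡ t ⟪ ζ ⟫
    ⟪⟫-local (var x) θ≗ζ = θ≗ζ x here
    ⟪⟫-local (fun f ts) θ≗ζ = cong (fun f) (⟪⟫s-local ts (λ x → θ≗ζ x ∘ there))

    ⟪⟫s-local : ∀ {θ ζ : Subst Sg} {k} (ts : Vec (Term Sg) k) →
                (∀ x → x ∈Vs ts → θ x ≡ ζ x) → ts ⟪ θ ⟫s ≡ ts ⟪ ζ ⟫s
    ⟪⟫s-local [] θ≗ζ = refl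
    ⟪⟫s-local (t ∷ ts) θ≗ζ =
      cong₂ _∷_ (⟪⟫-local t (λ x → θ≗ζ x ∘ hd)) (⟪⟫s-local ts (λ x → θ≗ζ x ∘ tl))

  ⟪⟫-cong : ∀ {θ ζ : Subst Sg} → (∀ x → θ x ≡ ζ x) → ∀ t → t ⟪ θ ⟫ ≡ t ⟪ ζ ⟫
  ⟪⟫-cong θ≗ζ t = ⟪⟫-local t (λ x _ → θ≗ζ x)

  mutual
    ⟪⟫-∘ˢ : ∀ (θ ζ : Subst Sg) t → t ⟪ θ ⟫ ⟪ ζ ⟫ ≡ t ⟪ θ ∘ˢ ζ ⟫
    ⟪⟫-∘ˢ θ ζ (var x) = refl
    ⟪⟫-∘ˢ θ ζ (fun f ts) = cong (fun f) (⟪⟫s-∘ˢ θ ζ ts)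

    ⟪⟫s-∘ˢ : ∀ (θ ζ : Subst Sg) {k} (ts : Vec (Term Sg) k) → ts ⟪ θ ⟫s ⟪ ζ ⟫s ≡ ts ⟪ θ ∘ˢ ζ ⟫s
    ⟪⟫s-∘ˢ θ ζ [] = refl
    ⟪⟫s-∘ˢ θ ζ (t ∷ ts) = cong₂ _∷_ (⟪⟫-∘ˢ θ ζ t) (⟪⟫s-∘ˢ θ ζ ts)

  ⟪⟫-absorb : ∀ {ρ θ : Subst Sg} → (∀ y → ρ y ⟪ θ ⟫ ≡ θ y) → ∀ t → t ⟪ ρ ⟫ ⟪ θ ⟫ ≡ t ⟪ θ ⟫
  ⟪⟫-absorb {ρ} {θ} ρθ≗θ t = trans (⟪⟫-∘ˢ ρ θ t) (⟪⟫-cong ρθ≗θ t)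

  Unifier⇒⟪⟫s : ∀ {k} {ss ts : Vec (Term Sg) k} {θ} → Unifier ss ts θ → ss ⟪ θ ⟫s ≡ ts ⟪ θ ⟫s
  Unifier⇒⟪⟫s {ss = []} {[]} U = refl
  Unifier⇒⟪⟫s {ss = s ∷ ss} {t ∷ ts} U = cong₂ _∷_ (U zero) (Unifier⇒⟪⟫s (U ∘ suc))

  ⟪⟫s⇒Unifier : ∀ {k} {ss ts : Vec (Term Sg) k} {θ} → ss ⟪ θ ⟫s ≡ ts ⟪ θ ⟫s → Unifier ss ts θ
  ⟪⟫s⇒Unifier {ss = s ∷ ss} {t ∷ ts} e zero = ∷-injectiveˡ e
  ⟪⟫s⇒Unifier {ss = s ∷ ss} {t ∷ ts} e (suc i) = ⟪⟫s⇒Unifier (∷-injectiveʳ e) i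

  IsMGU-cong : ∀ {m} {ss ss' ts ts' : Vec (Term Sg) m} {θ θ'} →
               ss ≡ ss' → ts ≡ ts' → (∀ x → θ x ≡ θ' x) → IsMGU ss ts θ → IsMGU ss' ts' θ'
  IsMGU-cong {ss = ss} {ts = ts} refl refl θ≗θ' (U , M) =
    (λ i → subst₂ _≡_ (⟪⟫-cong θ≗θ' (lookup ss i)) (⟪⟫-cong θ≗θ' (lookup ts i)) (U i)) ,
    λ θ'' U'' → let η , θ''≗θη = M θ'' U'' in
                η , λ x → trans (θ''≗θη x) (cong (_⟪ η ⟫) (θ≗θ' x))

  fun-injectiveˡ : ∀ {f g : Sym Sg} {xs ys} → _≡_ {A = Term Sg} (fun f xs) (fun g ys) → f ≡ g
  fun-injectiveˡ refl = refl

  fun-injectiveʳ : ∀ {f : Sym Sg} {xs ys} → _≡_ {A = Term Sg} (fun f xs) (fun f ys) → xs ≡ ys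
  fun-injectiveʳ refl = refl

  mutual
    size : Term Sg → ℕ
    size (var x) = 1
    size (fun f ts) = suc (sizes ts)

    sizes : ∀ {k} → Vec (Term Sg) k → ℕ
    sizes [] = 0
    sizes (t ∷ ts) = size t + sizes ts

  size-positive : ∀ t → 0 < size t
  size-positive (var x) = ≤-refl
  size-positive (fun f ts) = s≤s z≤n

  mutual
    ∈V⇒size≤ : ∀ {x} (θ : Subst Sg) t → x ∈V t → size (θ x) ≤ size (t ⟪ θ ⟫)
    ∈V⇒size≤ θ (var _) here = ≤-refl
    ∈V⇒size≤ θ (fun f ts) (there p) = m≤n⇒m≤1+n (∈Vs⇒size≤ θ ts p)

    ∈Vs⇒size≤ : ∀ {x} (θ : Subst Sg) {k} (ts : Vec (Term Sg) k) → x ∈Vs ts → size (θ x) ≤ sizes (ts ⟪ θ ⟫s)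
    ∈Vs⇒size≤ θ (t ∷ ts) (hd p) = ≤-trans (∈V⇒size≤ θ t p) (m≤m+n _ _)
    ∈Vs⇒size≤ θ (t ∷ ts) (tl p) = ≤-trans (∈Vs⇒size≤ θ ts p) (m≤n+m _ _)

  occurs-check : ∀ {x f ts} (θ : Subst Sg) → x ∈Vs ts → θ x ≢ fun f ts ⟪ θ ⟫
  occurs-check θ p θx≡ = <⇒≢ (s≤s (∈Vs⇒size≤ θ _ p)) (cong size θx≡)

  _↦_ : ℕ → Term Sg → Subst Sg
  (x ↦ v) y with y ≟ x
  ... | yes _ = v
  ... | no _ = var y

  ↦-self : ∀ x v → (x ↦ v) x ≡ v
  ↦-self x v with x ≟ x
  ... | yes _ = refl
  ... | no x≢x = ⊥-elim (x≢x refl)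

  ↦-fresh : ∀ {x v y} → ¬ x ∈V v → y ∈V v → (x ↦ v) y ≡ var y
  ↦-fresh {x} {v} {y} x∉v y∈v with y ≟ x
  ... | yes refl = ⊥-elim (x∉v y∈v)
  ... | no _ = refl

  ↦-respects : ∀ {B : Set} (F : Term Sg → B) {x v} → F (var x) ≡ F v → ∀ y → F ((x ↦ v) y) ≡ F (var y)
  ↦-respects F {x} Fx≡Fv y with y ≟ x
  ... | yes refl = sym Fx≡Fv
  ... | no _ = refl

Equalizes : ∀ {A B : Set} → (A → B) → List (A × A) → Set
Equalizes f = List.All (λ e → f (proj₁ e) ≡ f (proj₂ e))

Equalizes-cong : ∀ {A B : Set} {f g : A → B} {E} → (∀ u → f u ≡ g u) → Equalizes f E → Equalizes g E
Equalizes-cong f≗g = List.map (λ e → subst₂ _≡_ (f≗g _) (f≗g _) e)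

pairs : ∀ {A : Set} {k} → Vec A k → Vec A k → List (A × A)
pairs us vs = toList (zip us vs)

Equalizes-pairs⁺ : ∀ {A B : Set} {f : A → B} {k} (us vs : Vec A k) →
                   (∀ i → f (lookup us i) ≡ f (lookup vs i)) → Equalizes f (pairs us vs)
Equalizes-pairs⁺ [] [] _ = List.[]
Equalizes-pairs⁺ (u ∷ us) (v ∷ vs) e = e zero List.∷ Equalizes-pairs⁺ us vs (e ∘ suc)

Equalizes-pairs⁻ : ∀ {A B : Set} {f : A → B} {k} (us vs : Vec A k) →
                   Equalizes f (pairs us vs) → ∀ i → f (lookup us i) ≡ f (lookup vs i)
Equalizes-pairs⁻ (u ∷ us) (v ∷ vs) (e List.∷ _) zero = e
Equalizes-pairs⁻ (u ∷ us) (v ∷ vs) (_ List.∷ es) (suc i) = Equalizes-pairs⁻ us vs es i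

module Evaluation (Sg : Signature) where
  open Over Sg

  mutual
    plug-⟪⟫ : ∀ c → T (noVars c) → ∀ s (θ : Subst Sg) → plug c s ⟪ θ ⟫ ≡ plug c (s ⟪ θ ⟫)
    plug-⟪⟫ (var x) () s θ
    plug-⟪⟫ (fun (inj₁ f) ts) ground s θ = cong (fun f) (plugs-⟪⟫ ts ground s θ)
    plug-⟪⟫ (fun (inj₂ _) []) ground s θ = refl

    plugs-⟪⟫ : ∀ {k} (cs : Vec (Term CtxSig) k) → T (noVarss cs) → ∀ s (θ : Subst Sg) →
               plugs cs s ⟪ θ ⟫s ≡ plugs cs (s ⟪ θ ⟫)
    plugs-⟪⟫ [] _ s θ = refl
    plugs-⟪⟫ (c ∷ cs) ground s θ with Equivalence.to T-∧ ground
    ... | ground-c , ground-cs = cong₂ _∷_ (plug-⟪⟫ c ground-c s θ) (plugs-⟪⟫ cs ground-cs s θ)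

  mutual
    plug-injective : ∀ c → T (hasHole c) → ∀ {s s'} → plug c s ≡ plug c s' → s ≡ s'
    plug-injective (var x) () e
    plug-injective (fun (inj₁ f) cs) holey e = plugs-injective cs holey (fun-injectiveʳ e)
    plug-injective (fun (inj₂ _) []) holey e = e

    plugs-injective : ∀ {k} (cs : Vec (Term CtxSig) k) → T (hasHoles cs) →
                      ∀ {s s'} → plugs cs s ≡ plugs cs s' → s ≡ s'
    plugs-injective [] () e
    plugs-injective (c ∷ cs) holey e with Equivalence.to T-∨ holey
    ... | inj₁ holey-c = plug-injective c holey-c (∷-injectiveˡ e)
    ... | inj₂ holey-cs = plugs-injective cs holey-cs (∷-injectiveʳ e)

  ^⟨⟩-⟪⟫ : ∀ c k s (θ : Subst Sg) → (c ^ k ⟨ s ⟩) ⟪ θ ⟫ ≡ c ^ k ⟨ s ⟪ θ ⟫ ⟩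
  ^⟨⟩-⟪⟫ c zero s θ = refl
  ^⟨⟩-⟪⟫ c@(mkChi1 cx ground _) (suc k) s θ =
    trans (plug-⟪⟫ cx (recompute (T? (noVars cx)) ground) _ θ) (cong (plug cx) (^⟨⟩-⟪⟫ c k s θ))

  ^⟨⟩-injective : ∀ c k {s s'} → c ^ k ⟨ s ⟩ ≡ c ^ k ⟨ s' ⟩ → s ≡ s'
  ^⟨⟩-injective c zero e = e
  ^⟨⟩-injective c@(mkChi1 cx _ holey) (suc k) e =
    ^⟨⟩-injective c k (plug-injective cx (recompute (T? (hasHole cx)) holey) e)

  ^⟨⟩-+ : ∀ c p q s → c ^ p ⟨ c ^ q ⟨ s ⟩ ⟩ ≡ c ^ (p + q) ⟨ s ⟩
  ^⟨⟩-+ c zero q s = refl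
  ^⟨⟩-+ c (suc p) q s = cong (plug (ctx c)) (^⟨⟩-+ c p q s)

  ^ˢ-fixed : ∀ {σ : Subst Sg} {x} → σ x ≡ var x → ∀ n → (σ ^ˢ n) x ≡ var x
  ^ˢ-fixed σx≡x zero = refl
  ^ˢ-fixed {σ} σx≡x (suc n) = trans (cong (_⟪ σ ⟫) (^ˢ-fixed σx≡x n)) σx≡x

  ^ˢ-iterate : ∀ {σ : Subst Sg} {c a x} → σ x ≡ c ^ a ⟨ var x ⟩ → ∀ n → (σ ^ˢ n) x ≡ c ^ (a * n) ⟨ var x ⟩
  ^ˢ-iterate {c = c} {a} {x} σx zero = cong (λ k → c ^ k ⟨ var x ⟩) (sym (*-zeroʳ a))
  ^ˢ-iterate {σ} {c} {a} {x} σx (suc n) = begin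
    (σ ^ˢ n) x ⟪ σ ⟫                    ≡⟨ cong (_⟪ σ ⟫) (^ˢ-iterate {c = c} {a} σx n) ⟩
    (c ^ (a * n) ⟨ var x ⟩) ⟪ σ ⟫       ≡⟨ ^⟨⟩-⟪⟫ c (a * n) (var x) σ ⟩
    c ^ (a * n) ⟨ σ x ⟩                 ≡⟨ cong (λ s → c ^ (a * n) ⟨ s ⟩) σx ⟩
    c ^ (a * n) ⟨ c ^ a ⟨ var x ⟩ ⟩     ≡⟨ ^⟨⟩-+ c (a * n) a (var x) ⟩
    c ^ (a * n + a) ⟨ var x ⟩           ≡⟨ cong (λ k → c ^ k ⟨ var x ⟩) (trans (+-comm (a * n) a) (sym (*-suc a n))) ⟩
    c ^ (a * suc n) ⟨ var x ⟩           ∎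

  atˢ : Subst ExtSig → ℕ → Subst Sg
  atˢ θ n x = at (θ x) n

  mutual
    at-embed : ∀ s n → at (embed s) n ≡ s
    at-embed (var x) n = refl
    at-embed (fun f ts) n = cong (fun f) (ats-embeds ts n)

    ats-embeds : ∀ {k} (ts : Vec Tm k) n → ats (embeds ts) n ≡ ts
    ats-embeds [] n = refl
    ats-embeds (t ∷ ts) n = cong₂ _∷_ (at-embed t n) (ats-embeds ts n)

  mutual
    at-⟪⟫ : ∀ u (θ : Subst ExtSig) n → at (u ⟪ θ ⟫) n ≡ at u n ⟪ atˢ θ n ⟫
    at-⟪⟫ (var x) θ n = refl
    at-⟪⟫ (fun (inj₁ f) us) θ n = cong (fun f) (ats-⟪⟫s us θ n)
    at-⟪⟫ (fun (inj₂ (c , a , b)) (u ∷ [])) θ n =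
      trans (cong (λ s → c ^ (a * n + b) ⟨ s ⟩) (at-⟪⟫ u θ n))
            (sym (^⟨⟩-⟪⟫ c (a * n + b) (at u n) (atˢ θ n)))

    ats-⟪⟫s : ∀ {k} (us : Vec ETm k) (θ : Subst ExtSig) n → ats (us ⟪ θ ⟫s) n ≡ ats us n ⟪ atˢ θ n ⟫s
    ats-⟪⟫s [] θ n = refl
    ats-⟪⟫s (u ∷ us) θ n = cong₂ _∷_ (at-⟪⟫ u θ n) (ats-⟪⟫s us θ n)

  at-absorb : ∀ {ρ : Subst ExtSig} {n η} → (∀ y → at (ρ y) n ⟪ η ⟫ ≡ η y) →
              ∀ u → at (u ⟪ ρ ⟫) n ⟪ η ⟫ ≡ at u n ⟪ η ⟫
  at-absorb {ρ} {n} {η} ρη≗η u = trans (cong (_⟪ η ⟫) (at-⟪⟫ u ρ n)) (⟪⟫-absorb ρη≗η (at u n))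

  at-fun-injective : ∀ n (η : Subst Sg) f (us vs : Vec ETm (arity ExtSig f)) →
                     at (fun f us) n ⟪ η ⟫ ≡ at (fun f vs) n ⟪ η ⟫ → ats us n ⟪ η ⟫s ≡ ats vs n ⟪ η ⟫s
  at-fun-injective n η (inj₁ g) us vs e = fun-injectiveʳ e
  at-fun-injective n η (inj₂ (c , a , b)) (u ∷ []) (v ∷ []) e =
    cong (_∷ []) (^⟨⟩-injective c (a * n + b)
      (trans (sym (^⟨⟩-⟪⟫ c (a * n + b) (at u n) η)) (trans e (^⟨⟩-⟪⟫ c (a * n + b) (at v n) η))))

  evalPS-simple : ∀ {σ μ : Subst Sg} {c a b t x} → σ x ≡ c ^ a ⟨ var x ⟩ → μ x ≡ c ^ b ⟨ t ⟩ →
                  ∀ n → evalPS (σ , μ) n x ≡ at (ups c a b (embed t)) n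
  evalPS-simple {σ} {μ} {c} {a} {b} {t} {x} σx μx n = begin
    (σ ^ˢ n) x ⟪ μ ⟫                   ≡⟨ cong (_⟪ μ ⟫) (^ˢ-iterate {c = c} {a} σx n) ⟩
    (c ^ (a * n) ⟨ var x ⟩) ⟪ μ ⟫      ≡⟨ ^⟨⟩-⟪⟫ c (a * n) (var x) μ ⟩
    c ^ (a * n) ⟨ μ x ⟩                ≡⟨ cong (λ s → c ^ (a * n) ⟨ s ⟩) μx ⟩
    c ^ (a * n) ⟨ c ^ b ⟨ t ⟩ ⟩        ≡⟨ ^⟨⟩-+ c (a * n) b t ⟩
    c ^ (a * n + b) ⟨ t ⟩              ≡⟨ cong (λ s → c ^ (a * n + b) ⟨ s ⟩) (sym (at-embed t n)) ⟩
    c ^ (a * n + b) ⟨ at (embed t) n ⟩ ∎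

  InUps⇒evalPT : ∀ {p u} → InUps p u → ∀ n → evalPT p n ≡ at u n
  InUps⇒evalPT {s , σ , μ} {u} (θp , θp-spec , u∼sθp) n = begin
    (s ⟪ σ ^ˢ n ⟫) ⟪ μ ⟫         ≡⟨ ⟪⟫-∘ˢ (σ ^ˢ n) μ s ⟩
    s ⟪ evalPS (σ , μ) n ⟫       ≡⟨ ⟪⟫-local s agree ⟩
    s ⟪ atˢ θp n ⟫               ≡⟨ cong (_⟪ atˢ θp n ⟫) (sym (at-embed s n)) ⟩
    at (embed s) n ⟪ atˢ θp n ⟫  ≡⟨ sym (at-⟪⟫ (embed s) θp n) ⟩
    at (embed s ⟪ θp ⟫) n        ≡⟨ sym (u∼sθp n) ⟩
    at u n                       ∎
    where
    agree : ∀ x → x ∈V s → evalPS (σ , μ) n x ≡ at (θp x) n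
    agree x x∈s with θp-spec x x∈s
    ... | inj₁ (σx≡x , θpx≡) =
      trans (cong (_⟪ μ ⟫) (^ˢ-fixed σx≡x n)) (sym (trans (cong (λ w → at w n) θpx≡) (at-embed (μ x) n)))
    ... | inj₂ (_ , c , a , b , t , σx , μx , θpx≡) =
      trans (evalPS-simple {c = c} {a} {b} {t} σx μx n) (cong (λ w → at w n) (sym θpx≡))

  InUpsSeq⇒evalPTs : ∀ {m} (ps : Vec PatTerm m) us → InUpsSeq ps us → ∀ n → evalPTs ps n ≡ ats us n
  InUpsSeq⇒evalPTs [] [] _ n = refl
  InUpsSeq⇒evalPTs (p ∷ ps) (u ∷ us) I n =
    cong₂ _∷_ (InUps⇒evalPT {p} {u} (I zero) n) (InUpsSeq⇒evalPTs ps us (I ∘ suc) n)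

  IsUpsInv⇒evalPS : ∀ {θ ϑ} → IsUpsInv θ ϑ → ∀ n x → evalPS ϑ n x ≡ atˢ θ n x
  IsUpsInv⇒evalPS {θ} {σ , μ} inv n x with inv x
  ... | c , a , b , t , θx∼ , σx , μx = trans (evalPS-simple {c = c} {a} {b} {t} σx μx n) (sym (θx∼ n))

  Equations : Set
  Equations = List (ETm × ETm)

  infix 4 _⊨_ _⊨[_]_

  _⊨_ : Subst ExtSig → Equations → Set
  θ ⊨ E = Equalizes (_⟪ θ ⟫) E

  _⊨[_]_ : Subst Sg → ℕ → Equations → Set
  η ⊨[ n ] E = Equalizes (λ u → at u n ⟪ η ⟫) E

  _⟪_⟫ₑ : Equations → Subst ExtSig → Equations
  E ⟪ ρ ⟫ₑ = map (×-map (_⟪ ρ ⟫) (_⟪ ρ ⟫)) E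

  ⊨-⟪⟫ₑ : ∀ {ρ θ E} → (∀ y → ρ y ⟪ θ ⟫ ≡ θ y) → θ ⊨ E → θ ⊨ E ⟪ ρ ⟫ₑ
  ⊨-⟪⟫ₑ ρθ≗θ = map⁺ ∘ Equalizes-cong (sym ∘ ⟪⟫-absorb ρθ≗θ)

  ⟪⟫ₑ-⊨ : ∀ {ρ θ E} → θ ⊨ E ⟪ ρ ⟫ₑ → (ρ ∘ˢ θ) ⊨ E
  ⟪⟫ₑ-⊨ {ρ} {θ} = Equalizes-cong (⟪⟫-∘ˢ ρ θ) ∘ map⁻

  ⊨[]-⟪⟫ₑ : ∀ {ρ n η E} → (∀ y → at (ρ y) n ⟪ η ⟫ ≡ η y) → η ⊨[ n ] E → η ⊨[ n ] E ⟪ ρ ⟫ₑ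
  ⊨[]-⟪⟫ₑ {ρ} ρη≗η = map⁺ ∘ Equalizes-cong (sym ∘ at-absorb {ρ} ρη≗η)

  Unifier-ats⇒⊨[] : ∀ {k n η} (us vs : Vec ETm k) → Unifier (ats us n) (ats vs n) η → η ⊨[ n ] pairs us vs
  Unifier-ats⇒⊨[] [] [] _ = List.[]
  Unifier-ats⇒⊨[] (u ∷ us) (v ∷ vs) U = U zero List.∷ Unifier-ats⇒⊨[] us vs (U ∘ suc)

  weight : Subst ExtSig → Equations → ℕ
  weight θ E = sum (map (λ e → size (proj₁ e ⟪ θ ⟫)) E)

  weight-tail< : ∀ θ e E → weight θ E < weight θ (e ∷ E)
  weight-tail< θ e E = m<n+m (weight θ E) (size-positive (proj₁ e ⟪ θ ⟫))

  weight-⟪⟫ₑ : ∀ {ρ θ} → (∀ y → ρ y ⟪ θ ⟫ ≡ θ y) → ∀ E → weight θ (E ⟪ ρ ⟫ₑ) ≡ weight θ E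
  weight-⟪⟫ₑ ρθ≗θ [] = refl
  weight-⟪⟫ₑ ρθ≗θ ((u , v) ∷ E) = cong₂ _+_ (cong size (⟪⟫-absorb ρθ≗θ u)) (weight-⟪⟫ₑ ρθ≗θ E)

  weight-pairs-++ : ∀ θ {k} (us vs : Vec ETm k) R → weight θ (pairs us vs ++ R) ≡ sizes (us ⟪ θ ⟫s) + weight θ R
  weight-pairs-++ θ [] [] R = refl
  weight-pairs-++ θ (u ∷ us) (v ∷ vs) R =
    trans (cong (size (u ⟪ θ ⟫) +_) (weight-pairs-++ θ us vs R)) (sym (+-assoc (size (u ⟪ θ ⟫)) _ _))

  -- absorbs makes solution(n) an idempotent mgu of E(n), uniformly in n.
  record Solution (E : Equations) : Set where
    field
      solution : Subst ExtSig
      solves   : solution ⊨ E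
      absorbs  : ∀ n η → η ⊨[ n ] E → ∀ x → at (solution x) n ⟪ η ⟫ ≡ η x
  open Solution

  Solution-[] : Solution []
  Solution-[] = record { solution = var ; solves = List.[] ; absorbs = λ _ _ _ _ → refl }

  Solution-refl : ∀ {u R} → Solution R → Solution ((u , u) ∷ R)
  Solution-refl S = record
    { solution = solution S
    ; solves   = refl List.∷ solves S
    ; absorbs  = λ { n η (_ List.∷ H) → absorbs S n η H } }

  Solution-swap : ∀ {u v R} → Solution ((u , v) ∷ R) → Solution ((v , u) ∷ R)
  Solution-swap S with solves S
  ... | e List.∷ es = record
    { solution = solution S
    ; solves   = sym e List.∷ es
    ; absorbs  = λ { n η (e' List.∷ H) → absorbs S n η (sym e' List.∷ H) } }

  Solution-eliminate : ∀ {x v R} → ¬ x ∈V v → Solution (R ⟪ x ↦ v ⟫ₑ) → Solution ((var x , v) ∷ R)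
  Solution-eliminate {x} {v} {R} x∉v S = record
    { solution = (x ↦ v) ∘ˢ θ₁
    ; solves   = solves-x List.∷ ⟪⟫ₑ-⊨ (solves S)
    ; absorbs  = absorbs-eliminated }
    where
    θ₁ = solution S

    solves-x : (x ↦ v) x ⟪ θ₁ ⟫ ≡ v ⟪ (x ↦ v) ∘ˢ θ₁ ⟫
    solves-x = begin
      (x ↦ v) x ⟪ θ₁ ⟫       ≡⟨ cong (_⟪ θ₁ ⟫) (↦-self x v) ⟩
      v ⟪ θ₁ ⟫               ≡⟨ ⟪⟫-local v (λ y y∈v → cong (_⟪ θ₁ ⟫) (sym (↦-fresh x∉v y∈v))) ⟩
      v ⟪ (x ↦ v) ∘ˢ θ₁ ⟫    ∎

    absorbs-eliminated : ∀ n η → η ⊨[ n ] ((var x , v) ∷ R) → ∀ y → at ((x ↦ v) y ⟪ θ₁ ⟫) n ⟪ η ⟫ ≡ η y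
    absorbs-eliminated n η (ηx≡ List.∷ H) y =
      trans (at-absorb {θ₁} (absorbs S n η (⊨[]-⟪⟫ₑ {x ↦ v} ρη≗η H)) ((x ↦ v) y)) (ρη≗η y)
      where
      ρη≗η : ∀ z → at ((x ↦ v) z) n ⟪ η ⟫ ≡ η z
      ρη≗η = ↦-respects (λ u → at u n ⟪ η ⟫) ηx≡

  Solution-decompose : ∀ {f} {us vs : Vec ETm (arity ExtSig f)} {R} →
                       Solution (pairs us vs ++ R) → Solution ((fun f us , fun f vs) ∷ R)
  Solution-decompose {f} {us} {vs} S with ++⁻ (pairs us vs) (solves S)
  ... | solves-args , solves-R = record
    { solution = solution S
    ; solves   = cong (fun f) (Unifier⇒⟪⟫s (Equalizes-pairs⁻ us vs solves-args)) List.∷ solves-R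
    ; absorbs  = λ { n η (e List.∷ H) → absorbs S n η
                       (++⁺ (Unifier-ats⇒⊨[] us vs (⟪⟫s⇒Unifier (at-fun-injective n η f us vs e))) H) } }

  module _ (θ : Subst ExtSig) where
    eliminated< : ∀ {x v} e R → θ x ≡ v ⟪ θ ⟫ → weight θ (R ⟪ x ↦ v ⟫ₑ) < weight θ (e ∷ R)
    eliminated< e R θx≡ =
      subst (_< _) (sym (weight-⟪⟫ₑ (↦-respects (_⟪ θ ⟫) θx≡) R)) (weight-tail< θ e R)

    mutual
      solve : ∀ E → θ ⊨ E → Acc _<_ (weight θ E) → Solution E
      solve [] _ _ = Solution-[]
      solve ((var x , var y) ∷ R) (e List.∷ U) (acc rs) with x ≟ y
      ... | yes refl = Solution-refl (solve R U (rs (weight-tail< θ (var x , var x) R)))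
      ... | no x≢y =
        eliminate R e (λ { here → x≢y refl }) U (rs (eliminated< (var x , var y) R e))
      solve ((var x , fun f vs) ∷ R) (e List.∷ U) (acc rs) =
        eliminate R e (λ { (there p) → occurs-check θ p e }) U (rs (eliminated< (var x , fun f vs) R e))
      solve ((fun f us , var x) ∷ R) (e List.∷ U) (acc rs) =
        Solution-swap (eliminate R (sym e) (λ { (there p) → occurs-check θ p (sym e) }) U
                                 (rs (eliminated< (fun f us , var x) R (sym e))))
      solve ((fun f us , fun g vs) ∷ R) (e List.∷ U) (acc rs) with fun-injectiveˡ e
      ... | refl = Solution-decompose
        (solve (pairs us vs ++ R)
               (++⁺ (Equalizes-pairs⁺ us vs (⟪⟫s⇒Unifier (fun-injectiveʳ e))) U)
               (rs (s≤s (≤-reflexive (weight-pairs-++ θ us vs R)))))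

      eliminate : ∀ {x v} R → θ x ≡ v ⟪ θ ⟫ → ¬ x ∈V v → θ ⊨ R →
                  Acc _<_ (weight θ (R ⟪ x ↦ v ⟫ₑ)) → Solution ((var x , v) ∷ R)
      eliminate R θx≡ x∉v U a =
        Solution-eliminate x∉v (solve _ (⊨-⟪⟫ₑ (↦-respects (_⟪ θ ⟫) θx≡) U) a)

  unifiable⇒Solution : ∀ θ {E} → θ ⊨ E → Solution E
  unifiable⇒Solution θ {E} U = solve θ E U (<-wellFounded (weight θ E))

  IsMGU-at : ∀ {m} {us vs : Vec ETm m} {θ} → IsMGU us vs θ → ∀ n → IsMGU (ats us n) (ats vs n) (atˢ θ n)
  IsMGU-at {us = us} {vs} {θ} (U , M) n = unifier , general
    where
    unifier : Unifier (ats us n) (ats vs n) (atˢ θ n)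
    unifier = ⟪⟫s⇒Unifier (begin
      ats us n ⟪ atˢ θ n ⟫s  ≡⟨ sym (ats-⟪⟫s us θ n) ⟩
      ats (us ⟪ θ ⟫s) n      ≡⟨ cong (λ ws → ats ws n) (Unifier⇒⟪⟫s U) ⟩
      ats (vs ⟪ θ ⟫s) n      ≡⟨ ats-⟪⟫s vs θ n ⟩
      ats vs n ⟪ atˢ θ n ⟫s  ∎)

    S = unifiable⇒Solution θ (Equalizes-pairs⁺ us vs U)
    θ₀-instance = M (solution S) (Equalizes-pairs⁻ us vs (solves S))
    ζ = proj₁ θ₀-instance

    general : ∀ θ' → Unifier (ats us n) (ats vs n) θ' → ∃[ η ] (∀ x → θ' x ≡ atˢ θ n x ⟪ η ⟫)
    general θ' U' = atˢ ζ n ∘ˢ θ' , λ x → begin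
      θ' x                              ≡⟨ sym (absorbs S n θ' (Unifier-ats⇒⊨[] us vs U') x) ⟩
      at (solution S x) n ⟪ θ' ⟫        ≡⟨ cong (λ w → at w n ⟪ θ' ⟫) (proj₂ θ₀-instance x) ⟩
      at (θ x ⟪ ζ ⟫) n ⟪ θ' ⟫           ≡⟨ cong (_⟪ θ' ⟫) (at-⟪⟫ (θ x) ζ n) ⟩
      (at (θ x) n ⟪ atˢ ζ n ⟫) ⟪ θ' ⟫   ≡⟨ ⟪⟫-∘ˢ (atˢ ζ n) θ' (at (θ x) n) ⟩
      at (θ x) n ⟪ atˢ ζ n ∘ˢ θ' ⟫      ∎

theorem4p11 : (Sg : Signature) → let open Over Sg in
    (m : ℕ) (S S' : Vec PatTerm m) →
    All SimplePT S → All SimplePT S' →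
    (S₁ S₁' : Vec ETm m) → InUpsSeq S S₁ → InUpsSeq S' S₁' →
    (θ : Subst ExtSig) → IsMGU S₁ S₁' θ → SimpleSubst θ →
    (ϑ : PatSubst) → IsUpsInv θ ϑ → PatMGU S S' ϑ
theorem4p11 Sg m S S' _ _ S₁ S₁' S₁∈υS S₁'∈υS' θ θ-mgu _ ϑ ϑ≡υ⁻¹θ n =
  IsMGU-cong (sym (InUpsSeq⇒evalPTs S S₁ S₁∈υS n)) (sym (InUpsSeq⇒evalPTs S' S₁' S₁'∈υS' n))
    (λ x → sym (IsUpsInv⇒evalPS {θ} {ϑ} ϑ≡υ⁻¹θ n x))
    (IsMGU-at {us = S₁} {S₁'} {θ} θ-mgu n)
  where open Evaluation Sg
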